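{- Let $p$ be a prime, $n\geq 1$ an integer, and $F_1(n)=\prod_{k=1}^n k^{k!}$. Then $$\nu_p\left[F_1(n)\right]\leq (n+1)!-1 .$$
   Context: For a prime $p$ and a positive integer $m$, $\nu_p(m)=\max\{k\in\mathbb{N}: p^k\mid m\}$ denotes the $p$-adic valuation of $m$. -}

module Defs where

open import Data.Nat using (ℕ; zero; suc; _*_; _^_; _!)

F₁ : ℕ → ℕ
F₁ zero    = 1
F₁ (suc n) = F₁ n * (suc n ^ ((suc n) !))

{-# OPTIONS --safe #-}
module Submission where

-- Since p ≥ 2, p^k ∣ F₁ n forces 2^k ≤ F₁ n.  On the other hand 2 F₁ n ≤ 2^{(n+1)!}:
-- using n + 1 ≤ 2^n, the induction step is
--   2 F₁ (n+1) = 2 F₁ n · (n+1)^{(n+1)!} ≤ 2^{(n+1)!} · 2^{n (n+1)!} = 2^{(n+2)!}.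
-- Hence 2^{k+1} ≤ 2^{(n+1)!}, i.e. k ≤ (n+1)! - 1.

open import Defs
open import Data.Nat using (ℕ; zero; suc; _+_; _*_; _∸_; _^_; _!; _≤_; _<_; _≥_; z<s; s<s;
  NonZero; nonTrivial⇒n>1)
open import Data.Nat.Divisibility using (_∣_; ∣⇒≤)
open import Data.Nat.Primality using (Prime)
open import Data.Nat.Properties
open import Relation.Binary.PropositionalEquality using (sym; cong)

n<2^n : ∀ n → n < 2 ^ n
n<2^n zero    = z<s
n<2^n (suc n) = +-mono-≤ (m^n>0 2 n) (≤-trans (n<2^n n) (m≤m+n (2 ^ n) 0))

^-cancelʳ-≤ : ∀ m {a b} → 1 < m → m ^ a ≤ m ^ b → a ≤ b
^-cancelʳ-≤ m 1<m mᵃ≤mᵇ = ≮⇒≥ (λ b<a → ≤⇒≯ mᵃ≤mᵇ (^-monoʳ-< m 1<m b<a))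

F₁-nonZero : ∀ n → NonZero (F₁ n)
F₁-nonZero zero    = _
F₁-nonZero (suc n) =
  m*n≢0 (F₁ n) (suc n ^ (suc n !)) {{F₁-nonZero n}} {{m^n≢0 (suc n) (suc n !)}}

2*F₁[n]≤2^[1+n]! : ∀ n → 2 * F₁ n ≤ 2 ^ (suc n !)
2*F₁[n]≤2^[1+n]! zero    = ≤-refl
2*F₁[n]≤2^[1+n]! (suc n) = begin
  2 * (F₁ n * suc n ^ s)  ≡⟨ sym (*-assoc 2 (F₁ n) (suc n ^ s)) ⟩
  2 * F₁ n * suc n ^ s    ≤⟨ *-mono-≤ (2*F₁[n]≤2^[1+n]! n) (^-monoˡ-≤ s (n<2^n n)) ⟩
  2 ^ s * (2 ^ n) ^ s     ≡⟨ cong (2 ^ s *_) (^-*-assoc 2 n s) ⟩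
  2 ^ s * 2 ^ (n * s)     ≡⟨ sym (^-distribˡ-+-* 2 s (n * s)) ⟩
  2 ^ (s + n * s)         ≤⟨ ^-monoʳ-≤ 2 (+-monoʳ-≤ s (m≤n+m (n * s) s)) ⟩
  2 ^ (suc (suc n) !)     ∎
  where
    open ≤-Reasoning
    s : ℕ
    s = suc n !

mainTheorem4 : (p n : ℕ) → Prime p → n ≥ 1 →
    (k : ℕ) → p ^ k ∣ F₁ n → k ≤ ((suc n) !) ∸ 1
mainTheorem4 p n p-prime _ k pᵏ∣F₁n =
  ∸-monoˡ-≤ 1 (^-cancelʳ-≤ 2 {b = suc n !} (s<s z<s) 2^[1+k]≤2^[1+n]!)
  where
    open Prime p-prime
    open ≤-Reasoning
    2^[1+k]≤2^[1+n]! : 2 ^ suc k ≤ 2 ^ (suc n !)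
    2^[1+k]≤2^[1+n]! = begin
      2 * 2 ^ k      ≤⟨ *-monoʳ-≤ 2 (^-monoˡ-≤ k (nonTrivial⇒n>1 p)) ⟩
      2 * p ^ k      ≤⟨ *-monoʳ-≤ 2 (∣⇒≤ {{F₁-nonZero n}} pᵏ∣F₁n) ⟩
      2 * F₁ n       ≤⟨ 2*F₁[n]≤2^[1+n]! n ⟩
      2 ^ (suc n !)  ∎
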